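{- For all integers $n\ge 0$, $\overline{C}_{4,1}(2n+1)\equiv 0\pmod 2$.
   Context: An overpartition of $n$ is a partition of $n$ in which the first occurrence of each distinct part may optionally be overlined. $\overline{C}_{4,1}(n)$ denotes the number of overpartitions of $n$ in which no part is divisible by $4$ and only parts congruent to $\pm 1 \pmod{4}$ may be overlined; equivalently $\sum_{n\ge0}\overline{C}_{4,1}(n)q^n=\frac{(q^4;q^4)_\infty(-q;q^4)_\infty(-q^3;q^4)_\infty}{(q;q)_\infty}$, where $(A;q)_\infty=\prod_{j\ge0}(1-Aq^j)$. -}

module Defs where

open import Data.Nat using (ℕ; zero; suc; _+_; _*_; _∸_; _≤?_; _%_)
open import Data.Nat.Properties using (_≟_)
open import Data.List using (List; map; upTo)
open import Data.Nat.ListAction using (sum)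
open import Relation.Nullary.Decidable using (does)
open import Data.Bool using (if_then_else_)

-- Number of ways to use the part size k with multiplicity j in an
-- overpartition counted by C̄_{4,1}:
--   * multiplicity 0: one way (the part does not occur);
--   * parts divisible by 4 are forbidden;
--   * parts ≡ ±1 (mod 4), i.e. odd parts, occurring at least once:
--     the first occurrence may or may not be overlined (2 ways);
--   * parts ≡ 2 (mod 4) occurring at least once: cannot be overlined (1 way).
partWays : ℕ → ℕ → ℕ
partWays k zero    = 1
partWays k (suc j) =
  if does (k % 4 ≟ 0) then 0
  else (if does (k % 2 ≟ 1) then 2 else 1)

-- cnt k m = number of such overpartitions of m all of whose parts are ≤ k,
-- obtained by choosing, for the largest allowed part size suc k, its
-- multiplicity j (with j * (suc k) ≤ m) and its overline status.
cnt : ℕ → ℕ → ℕ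
cnt zero    zero    = 1
cnt zero    (suc m) = 0
cnt (suc k) m =
  sum (map (λ j → if does (j * suc k ≤? m)
                  then partWays (suc k) j * cnt k (m ∸ j * suc k)
                  else 0)
           (upTo (suc m)))

-- C̄_{4,1}(n): overpartitions of n (all parts are ≤ n).
C41 : ℕ → ℕ
C41 n = cnt n n

{-# OPTIONS --safe #-}
-- Expand cnt (k + 1) m by the multiplicity j of the part size k + 1.  A term
-- with j ≥ 1 carries the weight partWays = 0 (part divisible by 4) or
-- 2 (odd part, overlined or not) unless the part is even.  Every other term is
-- cnt k (m ∸ j * (k + 1)) with j * (k + 1) even, so for odd m the remainder is
-- odd again and the term is even by induction on k; finally cnt 0 m = 0 for
-- m ≠ 0.
module Submission where

open import Defs
open import Data.Nat using (ℕ; zero; suc; _*_; _∸_; _%_; _≤_; _<_; _≤?_; s≤s)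
open import Data.Nat.Properties using (_≟_; +-comm; n<1+n)
open import Data.Nat.Divisibility
  using ( _∣_; _∤_; divides; ∣m∣n⇒∣m+n; ∣m+n∣m⇒∣n; ∣m∸n∣n⇒∣m; m%n≡0⇒n∣m; >⇒∤
        ; m∣m*n; ∣n⇒∣m*n; ∣m⇒∣m*n)
open import Data.Nat.DivMod using (m%n<n)
open import Data.Nat.ListAction using (sum)
open import Data.List using ([]; _∷_; map; upTo)
open import Data.Bool using (if_then_else_)
open import Data.Sum using (_⊎_; inj₁; inj₂)
open import Relation.Nullary using (Dec; yes; no; ¬_; contradiction; does)
open import Function using (_∘_)
open import Relation.Binary.PropositionalEquality using (_≡_; _≢_; refl; subst)

sum-map-∣ : ∀ {d} (f : ℕ → ℕ) → (∀ x → d ∣ f x) → ∀ xs → d ∣ sum (map f xs)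
sum-map-∣ f d∣f []       = divides 0 refl
sum-map-∣ f d∣f (x ∷ xs) = ∣m∣n⇒∣m+n (d∣f x) (sum-map-∣ f d∣f xs)

2∤1+2*n : ∀ n → 2 ∤ suc (2 * n)
2∤1+2*n n 2∣1+2n = >⇒∤ (n<1+n 1) (∣m+n∣m⇒∣n (subst (2 ∣_) (+-comm 1 (2 * n)) 2∣1+2n) (m∣m*n n))

∤m∧∣n⇒∤m∸n : ∀ {d m n} → n ≤ m → d ∣ n → d ∤ m → d ∤ m ∸ n
∤m∧∣n⇒∤m∸n {d} n≤m d∣n d∤m d∣m∸n = d∤m (∣m∸n∣n⇒∣m d n≤m d∣m∸n d∣n)

m%2≢1⇒2∣m : ∀ m → m % 2 ≢ 1 → 2 ∣ m
m%2≢1⇒2∣m m m%2≢1 = m%n≡0⇒n∣m m 2 (r<2∧r≢1⇒r≡0 (m % 2) (m%n<n m 2) m%2≢1)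
  where
  r<2∧r≢1⇒r≡0 : ∀ r → r < 2 → r ≢ 1 → r ≡ 0
  r<2∧r≢1⇒r≡0 zero          _              _   = refl
  r<2∧r≢1⇒r≡0 (suc zero)    _              r≢1 = contradiction refl r≢1
  r<2∧r≢1⇒r≡0 (suc (suc r)) (s≤s (s≤s ())) _

if-does-elim : ∀ {a b p} {A : Set a} {B : Set b} (P : B → Set p) (a? : Dec A) {x y : B} →
               (A → P x) → (¬ A → P y) → P (if does a? then x else y)
if-does-elim P (yes a) on-yes _ = on-yes a
if-does-elim P (no ¬a) _ on-no = on-no ¬a

partWays-even⊎even : ∀ k j → 2 ∣ partWays k (suc j) ⊎ 2 ∣ k
partWays-even⊎even k j =
  if-does-elim P (k % 4 ≟ 0) (λ _ → inj₁ (divides 0 refl)) λ _ →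
  if-does-elim P (k % 2 ≟ 1) (λ _ → inj₁ (divides 1 refl)) (inj₂ ∘ m%2≢1⇒2∣m k)
  where
  P : ℕ → Set
  P w = 2 ∣ w ⊎ 2 ∣ k

odd⇒2∣cnt : ∀ k m → 2 ∤ m → 2 ∣ cnt k m
odd⇒2∣cnt zero    zero    2∤0 = contradiction (divides 0 refl) 2∤0
odd⇒2∣cnt zero    (suc m) _   = divides 0 refl
odd⇒2∣cnt (suc k) m       2∤m = sum-map-∣ _ term-even (upTo (suc m))
  where
  fitting-term-even : ∀ j → j * suc k ≤ m → 2 ∣ partWays (suc k) j * cnt k (m ∸ j * suc k)
  fitting-term-even zero    _ = ∣n⇒∣m*n 1 (odd⇒2∣cnt k m 2∤m)
  fitting-term-even (suc j) jk≤m with partWays-even⊎even (suc k) j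
  ... | inj₁ 2∣ways = ∣m⇒∣m*n _ 2∣ways
  ... | inj₂ 2∣k+1  = ∣n⇒∣m*n (partWays (suc k) (suc j)) (odd⇒2∣cnt k (m ∸ jk) 2∤m∸jk)
    where
    jk : ℕ
    jk = suc j * suc k
    2∤m∸jk : 2 ∤ m ∸ jk
    2∤m∸jk = ∤m∧∣n⇒∤m∸n jk≤m (∣n⇒∣m*n (suc j) 2∣k+1) 2∤m

  term-even : ∀ j → 2 ∣ (if does (j * suc k ≤? m)
                         then partWays (suc k) j * cnt k (m ∸ j * suc k)
                         else 0)
  term-even j = if-does-elim (2 ∣_) (j * suc k ≤? m) (fitting-term-even j) (λ _ → divides 0 refl)

mainTheorem20 : (n : ℕ) → 2 ∣ C41 (suc (2 * n))
mainTheorem20 n = odd⇒2∣cnt (suc (2 * n)) (suc (2 * n)) (2∤1+2*n n)
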